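{- Let $P=\forall X\forall Y(((X\to Y)\to X)\to X)$, $Q=P\to\forall X\,X$, $N=\forall X(X\to(X\to X)\to X)$, $D=(Q\to P)\to N$, $B=\forall X(X\to X\to X)$, $d_n=\lambda\alpha\,\underline{n}$ for $n\in\mathbf{N}$, and let $X$ be a type variable. Let $t$ be a normal $\lambda$-term. (1) If $x:B\to D\to X,\ y:X\vdash_{\mathcal{F}}t:B$, then $t=T$ or $t=F$. (2) If $x:B\to D\to X,\ y:X\vdash_{\mathcal{F}}t:D$, then there is $n\in\mathbf{N}$ with $t=d_n$.
   Context: $T=\lambda x\lambda y\,x$, $F=\lambda x\lambda y\,y$, $\underline{n}=\lambda x\lambda f(f^n\,x)$ (Church numeral). System $\mathcal{F}$ (Girard's second-order typed $\lambda$-calculus): types built from type variables and $\perp$ with $\to$ and $\forall X$; typing rules: variable, $\lambda$-abstraction, application, $\forall$-introduction (type variable not free in context), $\forall$-elimination. -}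

module Defs where

open import Data.Nat using (ℕ; zero; suc; _+_; _<ᵇ_; compare; less; equal; greater)
open import Data.Bool using (if_then_else_)
open import Data.List using (List; []; _∷_; map)

-- Types of System F (de Bruijn indices for type variables)

infixr 7 _⇒_

data Ty : Set where
  tvar : ℕ → Ty
  ⊥'   : Ty
  _⇒_  : Ty → Ty → Ty
  ∀'   : Ty → Ty          -- ∀-binder; index 0 refers to the bound variable

shiftVar : ℕ → ℕ → ℕ
shiftVar c n = if n <ᵇ c then n else suc n

shift : ℕ → Ty → Ty
shift c (tvar n) = tvar (shiftVar c n)
shift c ⊥'       = ⊥'
shift c (A ⇒ B)  = shift c A ⇒ shift c B
shift c (∀' A)   = ∀' (shift (suc c) A)

-- substitute s for variable j, lowering variables above j
subVar : ℕ → Ty → ℕ → Ty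
subVar j s n with compare n j
... | less .n k    = tvar n
... | equal .n     = s
... | greater .j k = tvar (j + k)

sub : ℕ → Ty → Ty → Ty
sub j s (tvar n) = subVar j s n
sub j s ⊥'       = ⊥'
sub j s (A ⇒ B)  = sub j s A ⇒ sub j s B
sub j s (∀' A)   = ∀' (sub (suc j) (shift 0 s) A)

inst : Ty → Ty → Ty
inst A S = sub 0 S A

-- Pure (untyped) λ-terms, de Bruijn indices (so = is α-equivalence)

data Tm : Set where
  var : ℕ → Tm
  lam : Tm → Tm
  app : Tm → Tm → Tm

data Ne : Tm → Set
data Nf : Tm → Set

data Ne where
  var : ∀ n → Ne (var n)
  app : ∀ {t u} → Ne t → Nf u → Ne (app t u)

data Nf where
  ne  : ∀ {t} → Ne t → Nf t
  lam : ∀ {t} → Nf t → Nf (lam t)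

-- Curry-style typing of System F. A context is a list of types; term
-- variable index 0 is the most recently declared (rightmost) one.

Ctx : Set
Ctx = List Ty

data _∋_∶_ : Ctx → ℕ → Ty → Set where
  here  : ∀ {Γ A} → (A ∷ Γ) ∋ zero ∶ A
  there : ∀ {Γ A B n} → Γ ∋ n ∶ A → (B ∷ Γ) ∋ suc n ∶ A

infix 4 _⊢_∶_

data _⊢_∶_ : Ctx → Tm → Ty → Set where
  ⊢var : ∀ {Γ n A} → Γ ∋ n ∶ A → Γ ⊢ var n ∶ A
  ⊢lam : ∀ {Γ t A B} → (A ∷ Γ) ⊢ t ∶ B → Γ ⊢ lam t ∶ A ⇒ B
  ⊢app : ∀ {Γ t u A B} → Γ ⊢ t ∶ A ⇒ B → Γ ⊢ u ∶ A → Γ ⊢ app t u ∶ B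
  -- ∀-intro: the fresh type variable (index 0) is not free in the
  -- (shifted) context
  ⊢gen : ∀ {Γ t A} → map (shift 0) Γ ⊢ t ∶ A → Γ ⊢ t ∶ ∀' A
  ⊢ins : ∀ {Γ t A S} → Γ ⊢ t ∶ ∀' A → Γ ⊢ t ∶ inst A S

Tt Ff : Tm
Tt = lam (lam (var 1))
Ff = lam (lam (var 0))

church : ℕ → Tm
church n = lam (lam (iter n))
  where
  iter : ℕ → Tm
  iter zero    = var 1
  iter (suc k) = app (var 0) (iter k)

d : ℕ → Tm
d n = lam (church n)

-- P = ∀X∀Y(((X→Y)→X)→X)   (X = index 1, Y = index 0 in the body)
Pty : Ty
Pty = ∀' (∀' (((tvar 1 ⇒ tvar 0) ⇒ tvar 1) ⇒ tvar 1))

Qty : Ty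
Qty = Pty ⇒ ∀' (tvar 0)

Nty : Ty
Nty = ∀' (tvar 0 ⇒ (tvar 0 ⇒ tvar 0) ⇒ tvar 0)

Dty : Ty
Dty = (Qty ⇒ Pty) ⇒ Nty

Bty : Ty
Bty = ∀' (tvar 0 ⇒ tvar 0 ⇒ tvar 0)

Xty : Ty
Xty = tvar 0

-- context  x : B→D→X , y : X   (y = term index 0, x = term index 1)
Γ₀ : Ctx
Γ₀ = Xty ∷ (Bty ⇒ Dty ⇒ Xty) ∷ []

-- A β-normal term is either a λ-abstraction or a variable applied to arguments. By the
-- generation lemmas, a typing of the latter is a spine of eliminations starting from the
-- type of the head variable, so its codomain (`target`) is the head's whenever that is a
-- type variable. In the contexts met below every variable has such a type, except the
-- bound α : Q → P, and applying α would inhabit Q = P → ∀X X, which is false under every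
-- two-valued valuation since Peirce's law P is a tautology. Hence a normal inhabitant of
-- B or D is forced to be a stack of λ's over an atomic body: one of the two bound
-- variables for B, and f (f (… z)) for D.

module Submission where

open import Defs
open import Data.Nat using (ℕ; zero; suc; _+_; _<_; _≤_; z≤n; s≤s; _<ᵇ_; _<?_; compare; less; equal; greater)
open import Data.Nat.Properties using (<-cmp; ≤-refl; ≤-trans; <-irrefl; <-asym; m≤m+n; n≤1+n; m≤n⇒m≤1+n; ≮⇒≥)
open import Data.Bool using (Bool; true; false; T; not; _∧_; _∨_)
open import Data.Bool.Properties using (T-∧)
open import Data.List using ([]; _∷_; map)
open import Data.List.Relation.Unary.All using (All; []; _∷_)
import Data.List.Relation.Unary.All as All
open import Data.List.Relation.Unary.All.Properties using (map⁺)
open import Data.Product using (_×_; _,_; Σ; proj₁; proj₂)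
open import Data.Sum using (_⊎_; inj₁; inj₂)
open import Data.Empty using (⊥-elim)
open import Data.Unit using (tt)
open import Function using (_∘_; case_of_)
open import Function.Bundles using (Equivalence)
open import Relation.Binary using (tri<; tri≈; tri>)
open import Relation.Binary.PropositionalEquality hiding ([_])
open import Relation.Nullary using (¬_; yes; no)

data VarView (j : ℕ) : ℕ → Set where
  below : ∀ {n} → n < j → VarView j n
  at    : VarView j j
  above : ∀ {m} → j ≤ m → VarView j (suc m)

varView : ∀ j n → VarView j n
varView j n with <-cmp n j
... | tri< n<j _ _        = below n<j
... | tri≈ _ refl _       = at
... | tri> _ _ (s≤s j≤m) = above j≤m

shiftVar-suc : ∀ c n → shiftVar (suc c) (suc n) ≡ suc (shiftVar c n)
shiftVar-suc c n with n <ᵇ c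
... | true  = refl
... | false = refl

shiftVar-< : ∀ {c n} → n < c → shiftVar c n ≡ n
shiftVar-< {suc c} {zero}  _         = refl
shiftVar-< {suc c} {suc n} (s≤s n<c) = trans (shiftVar-suc c n) (cong suc (shiftVar-< n<c))

shiftVar-≥ : ∀ {c n} → c ≤ n → shiftVar c n ≡ suc n
shiftVar-≥ {zero}          _         = refl
shiftVar-≥ {suc c} {suc n} (s≤s c≤n) = trans (shiftVar-suc c n) (cong suc (shiftVar-≥ c≤n))

shiftVar-≤ : ∀ c n → shiftVar c n ≤ suc n
shiftVar-≤ c n with n <ᵇ c
... | true  = n≤1+n n
... | false = ≤-refl

shiftVar-comm : ∀ {d c} n → d ≤ c → shiftVar (suc c) (shiftVar d n) ≡ shiftVar d (shiftVar c n)
shiftVar-comm {zero}  {c}     n       _         = shiftVar-suc c n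
shiftVar-comm {suc d} {suc c} zero    _         = refl
shiftVar-comm {suc d} {suc c} (suc n) (s≤s d≤c) = begin
  shiftVar (suc (suc c)) (shiftVar (suc d) (suc n)) ≡⟨ cong (shiftVar (suc (suc c))) (shiftVar-suc d n) ⟩
  shiftVar (suc (suc c)) (suc (shiftVar d n))       ≡⟨ shiftVar-suc (suc c) (shiftVar d n) ⟩
  suc (shiftVar (suc c) (shiftVar d n))             ≡⟨ cong suc (shiftVar-comm n d≤c) ⟩
  suc (shiftVar d (shiftVar c n))                   ≡⟨ sym (shiftVar-suc d (shiftVar c n)) ⟩
  shiftVar (suc d) (suc (shiftVar c n))             ≡⟨ cong (shiftVar (suc d)) (sym (shiftVar-suc c n)) ⟩
  shiftVar (suc d) (shiftVar (suc c) (suc n))       ∎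
  where open ≡-Reasoning

subVar-< : ∀ {j S n} → n < j → subVar j S n ≡ tvar n
subVar-< {j} {S} {n} n<j with compare n j
... | less .n k    = refl
... | equal .n     = ⊥-elim (<-irrefl refl n<j)
... | greater .j k = ⊥-elim (<-asym n<j (s≤s (m≤m+n j k)))

subVar-≡ : ∀ {j S n} → n ≡ j → subVar j S n ≡ S
subVar-≡ {j} {S} {n} n≡j with compare n j
... | less .n k    = ⊥-elim (<-irrefl n≡j (s≤s (m≤m+n n k)))
... | equal .n     = refl
... | greater .j k = ⊥-elim (<-irrefl (sym n≡j) (s≤s (m≤m+n j k)))

subVar-> : ∀ {j S m} → j ≤ m → subVar j S (suc m) ≡ tvar m
subVar-> {j} {S} {m} j≤m with compare (suc m) j
... | less .(suc m) k = ⊥-elim (<-irrefl refl (≤-trans (s≤s (≤-trans (n≤1+n m) (m≤m+n (suc m) k))) j≤m))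
... | equal .(suc m)  = ⊥-elim (<-irrefl refl (s≤s j≤m))
... | greater .j k    = refl

sub-shift : ∀ c S A → sub c S (shift c A) ≡ A
sub-shift c S (tvar n) with n <? c
... | yes n<c rewrite shiftVar-< n<c         = subVar-< n<c
... | no  n≮c rewrite shiftVar-≥ (≮⇒≥ n≮c) = subVar-> (≮⇒≥ n≮c)
sub-shift c S ⊥'      = refl
sub-shift c S (A ⇒ B) = cong₂ _⇒_ (sub-shift c S A) (sub-shift c S B)
sub-shift c S (∀' A)  = cong ∀' (sub-shift (suc c) (shift 0 S) A)

shift-shift : ∀ {d c} A → d ≤ c → shift (suc c) (shift d A) ≡ shift d (shift c A)
shift-shift (tvar n) d≤c = cong tvar (shiftVar-comm n d≤c)
shift-shift ⊥'       d≤c = refl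
shift-shift (A ⇒ B)  d≤c = cong₂ _⇒_ (shift-shift A d≤c) (shift-shift B d≤c)
shift-shift (∀' A)   d≤c = cong ∀' (shift-shift A (s≤s d≤c))

shift-sub : ∀ c j S A → c ≤ j → shift c (sub j S A) ≡ sub (suc j) (shift c S) (shift c A)
shift-sub c j S (tvar n) c≤j with varView j n
... | below n<j rewrite subVar-< {S = S} n<j =
  sym (subVar-< (s≤s (≤-trans (shiftVar-≤ c n) n<j)))
... | at rewrite subVar-≡ {j} {S} refl | shiftVar-≥ c≤j =
  sym (subVar-≡ refl)
... | above {m} j≤m rewrite subVar-> {S = S} j≤m | shiftVar-≥ (≤-trans c≤j j≤m)
                          | shiftVar-≥ (≤-trans c≤j (m≤n⇒m≤1+n j≤m)) =
  sym (subVar-> (s≤s j≤m))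
shift-sub c j S ⊥'      c≤j = refl
shift-sub c j S (A ⇒ B) c≤j = cong₂ _⇒_ (shift-sub c j S A c≤j) (shift-sub c j S B c≤j)
shift-sub c j S (∀' A)  c≤j = cong ∀' (begin
  shift (suc c) (sub (suc j) (shift 0 S) A)
    ≡⟨ shift-sub (suc c) (suc j) (shift 0 S) A (s≤s c≤j) ⟩
  sub (suc (suc j)) (shift (suc c) (shift 0 S)) (shift (suc c) A)
    ≡⟨ cong (λ S′ → sub (suc (suc j)) S′ (shift (suc c) A)) (shift-shift S z≤n) ⟩
  sub (suc (suc j)) (shift 0 (shift c S)) (shift (suc c) A) ∎)
  where open ≡-Reasoning

sub-subVar : ∀ c j S T n →
  sub (c + j) S (subVar c T n) ≡ sub c (sub (c + j) S T) (subVar (suc (c + j)) (shift c S) n)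
sub-subVar c j S T n with varView c n
... | below n<c
  rewrite subVar-< {S = T} n<c | subVar-< {S = S} (≤-trans n<c (m≤m+n c j))
        | subVar-< {S = shift c S} (≤-trans n<c (≤-trans (m≤m+n c j) (n≤1+n (c + j)))) =
  sym (subVar-< n<c)
... | at rewrite subVar-≡ {c} {T} refl | subVar-< {S = shift c S} (s≤s (m≤m+n c j)) =
  sym (subVar-≡ refl)
... | above {m} c≤m rewrite subVar-> {S = T} c≤m with varView (c + j) m
...   | below m<c+j rewrite subVar-< {S = S} m<c+j | subVar-< {S = shift c S} (s≤s m<c+j) =
  sym (subVar-> c≤m)
...   | at rewrite subVar-≡ {c + j} {S} refl | subVar-≡ {suc (c + j)} {shift c S} refl =
  sym (sub-shift c (sub (c + j) S T) S)
...   | above {m′} c+j≤m′ rewrite subVar-> {S = S} c+j≤m′ | subVar-> {S = shift c S} (s≤s c+j≤m′) =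
  sym (subVar-> (≤-trans (m≤m+n c j) c+j≤m′))

sub-sub : ∀ c j S T A → sub (c + j) S (sub c T A) ≡ sub c (sub (c + j) S T) (sub (suc (c + j)) (shift c S) A)
sub-sub c j S T (tvar n) = sub-subVar c j S T n
sub-sub c j S T ⊥'       = refl
sub-sub c j S T (A ⇒ B)  = cong₂ _⇒_ (sub-sub c j S T A) (sub-sub c j S T B)
sub-sub c j S T (∀' A)   = cong ∀' (begin
  sub (suc (c + j)) (shift 0 S) (sub (suc c) (shift 0 T) A)
    ≡⟨ sub-sub (suc c) j (shift 0 S) (shift 0 T) A ⟩
  sub (suc c) (sub (suc (c + j)) (shift 0 S) (shift 0 T)) (sub (suc (suc (c + j))) (shift (suc c) (shift 0 S)) A)
    ≡⟨ cong₂ (λ T′ S′ → sub (suc c) T′ (sub (suc (suc (c + j))) S′ A))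
             (sym (shift-sub 0 (c + j) S T z≤n)) (shift-shift S z≤n) ⟩
  sub (suc c) (shift 0 (sub (c + j) S T)) (sub (suc (suc (c + j))) (shift 0 (shift c S)) A) ∎)
  where open ≡-Reasoning

∋-map : ∀ (f : Ty → Ty) {Γ n A} → Γ ∋ n ∶ A → map f Γ ∋ n ∶ f A
∋-map f here      = here
∋-map f (there p) = there (∋-map f p)

∋-functional : ∀ {Γ n A B} → Γ ∋ n ∶ A → Γ ∋ n ∶ B → A ≡ B
∋-functional here      here      = refl
∋-functional (there p) (there q) = ∋-functional p q

map-sub-shift : ∀ S Γ → map (sub 0 S) (map (shift 0) Γ) ≡ Γ
map-sub-shift S []      = refl
map-sub-shift S (A ∷ Γ) = cong₂ _∷_ (sub-shift 0 S A) (map-sub-shift S Γ)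

map-sub-shift-comm : ∀ j S Γ →
  map (sub (suc j) (shift 0 S)) (map (shift 0) Γ) ≡ map (shift 0) (map (sub j S) Γ)
map-sub-shift-comm j S []      = refl
map-sub-shift-comm j S (A ∷ Γ) = cong₂ _∷_ (sym (shift-sub 0 j S A z≤n)) (map-sub-shift-comm j S Γ)

sub-inst : ∀ j S T A → sub j S (inst A T) ≡ inst (sub (suc j) (shift 0 S) A) (sub j S T)
sub-inst j S T A = sub-sub 0 j S T A

sub-⊢ : ∀ j S {Γ t A} → Γ ⊢ t ∶ A → map (sub j S) Γ ⊢ t ∶ sub j S A
sub-⊢ j S (⊢var p)   = ⊢var (∋-map (sub j S) p)
sub-⊢ j S (⊢lam d)   = ⊢lam (sub-⊢ j S d)
sub-⊢ j S (⊢app d e) = ⊢app (sub-⊢ j S d) (sub-⊢ j S e)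
sub-⊢ j S {Γ} (⊢gen d) =
  ⊢gen (subst (_⊢ _ ∶ _) (map-sub-shift-comm j S Γ) (sub-⊢ (suc j) (shift 0 S) d))
sub-⊢ j S (⊢ins {A = A} {S = T} d) = subst (_ ⊢ _ ∶_) (sym (sub-inst j S T A)) (⊢ins (sub-⊢ j S d))

data LamTyping : Ctx → Tm → Ty → Set where
  ⇒-intro : ∀ {Γ t A B} → (A ∷ Γ) ⊢ t ∶ B → LamTyping Γ t (A ⇒ B)
  ∀-intro : ∀ {Γ t A} → LamTyping (map (shift 0) Γ) t A → LamTyping Γ t (∀' A)

sub-LamTyping : ∀ j S {Γ t A} → LamTyping Γ t A → LamTyping (map (sub j S) Γ) t (sub j S A)
sub-LamTyping j S (⇒-intro d) = ⇒-intro (sub-⊢ j S d)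
sub-LamTyping j S {Γ} (∀-intro l) =
  ∀-intro (subst (λ Δ → LamTyping Δ _ _) (map-sub-shift-comm j S Γ) (sub-LamTyping (suc j) (shift 0 S) l))

lam-inv : ∀ {Γ t C} → Γ ⊢ lam t ∶ C → LamTyping Γ t C
lam-inv (⊢lam d) = ⇒-intro d
lam-inv (⊢gen d) = ∀-intro (lam-inv d)
lam-inv {Γ} (⊢ins {S = S} d) with lam-inv d
... | ∀-intro l = subst (λ Δ → LamTyping Δ _ _) (map-sub-shift S Γ) (sub-LamTyping 0 S l)

data Spine (Γ : Ctx) (h : ℕ) : Tm → Ty → Set where
  head : ∀ {A} → Γ ∋ h ∶ A → Spine Γ h (var h) A
  _·_  : ∀ {t u A B} → Spine Γ h t (A ⇒ B) → Γ ⊢ u ∶ A → Spine Γ h (app t u) B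
  _[_] : ∀ {t A} → Spine Γ h t (∀' A) → ∀ S → Spine Γ h t (inst A S)

-- The head's typing is repeated in `spine` so that splitting on it names the head variable.
data NeTyping : Ctx → Tm → Ty → Set where
  spine : ∀ {Γ h t C H} → Γ ∋ h ∶ H → Spine Γ h t C → NeTyping Γ t C
  gen   : ∀ {Γ t A} → NeTyping (map (shift 0) Γ) t A → NeTyping Γ t (∀' A)

sub-Spine : ∀ j S {Γ h t A} → Spine Γ h t A → Spine (map (sub j S) Γ) h t (sub j S A)
sub-Spine j S (head p) = head (∋-map (sub j S) p)
sub-Spine j S (s · d)  = sub-Spine j S s · sub-⊢ j S d
sub-Spine j S (_[_] {A = A} s T) =
  subst (Spine _ _ _) (sym (sub-inst j S T A)) ((sub-Spine j S s) [ sub j S T ])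

sub-NeTyping : ∀ j S {Γ t A} → NeTyping Γ t A → NeTyping (map (sub j S) Γ) t (sub j S A)
sub-NeTyping j S (spine p s) = spine (∋-map (sub j S) p) (sub-Spine j S s)
sub-NeTyping j S {Γ} (gen n) =
  gen (subst (λ Δ → NeTyping Δ _ _) (map-sub-shift-comm j S Γ) (sub-NeTyping (suc j) (shift 0 S) n))

-- A ∀-elimination directly after a ∀-introduction is absorbed by `sub-NeTyping`,
-- so ∀-introductions only occur outermost.
ne-inv : ∀ {Γ t C} → Ne t → Γ ⊢ t ∶ C → NeTyping Γ t C
ne-inv (var n) (⊢var p) = spine p (head p)
ne-inv (app nt _) (⊢app d e) with ne-inv nt d
... | spine p s = spine p (s · e)
ne-inv nt (⊢gen d) = gen (ne-inv nt d)
ne-inv {Γ} nt (⊢ins {S = S} d) with ne-inv nt d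
... | spine p s = spine p (s [ S ])
... | gen n     = subst (λ Δ → NeTyping Δ _ _) (map-sub-shift S Γ) (sub-NeTyping 0 S n)

Valuation : Set
Valuation = ℕ → Bool

_∷ᵛ_ : Bool → Valuation → Valuation
(b ∷ᵛ ρ) zero    = b
(b ∷ᵛ ρ) (suc n) = ρ n

⟦_⟧ : Ty → Valuation → Bool
⟦ tvar n ⟧ ρ = ρ n
⟦ ⊥' ⟧    ρ = false
⟦ A ⇒ B ⟧ ρ = not (⟦ A ⟧ ρ) ∨ ⟦ B ⟧ ρ
⟦ ∀' A ⟧  ρ = ⟦ A ⟧ (true ∷ᵛ ρ) ∧ ⟦ A ⟧ (false ∷ᵛ ρ)

infix 4 _⊨_

_⊨_ : Valuation → Ty → Set
ρ ⊨ A = T (⟦ A ⟧ ρ)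

shift-⟦⟧ : ∀ c A {ρ σ} → (∀ n → ρ (shiftVar c n) ≡ σ n) → ⟦ shift c A ⟧ ρ ≡ ⟦ A ⟧ σ
shift-⟦⟧ c (tvar n) ρ≡σ = ρ≡σ n
shift-⟦⟧ c ⊥'       ρ≡σ = refl
shift-⟦⟧ c (A ⇒ B)  ρ≡σ = cong₂ (λ a b → not a ∨ b) (shift-⟦⟧ c A ρ≡σ) (shift-⟦⟧ c B ρ≡σ)
shift-⟦⟧ c (∀' A) {ρ} {σ} ρ≡σ =
  cong₂ _∧_ (shift-⟦⟧ (suc c) A (extend true)) (shift-⟦⟧ (suc c) A (extend false))
  where
  extend : ∀ b n → (b ∷ᵛ ρ) (shiftVar (suc c) n) ≡ (b ∷ᵛ σ) n
  extend b zero    = refl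
  extend b (suc n) = trans (cong (b ∷ᵛ ρ) (shiftVar-suc c n)) (ρ≡σ n)

shift-⟦⟧-∷ : ∀ A b ρ → ⟦ shift 0 A ⟧ (b ∷ᵛ ρ) ≡ ⟦ A ⟧ ρ
shift-⟦⟧-∷ A b ρ = shift-⟦⟧ 0 A (λ _ → refl)

insert : ℕ → Bool → Valuation → Valuation
insert zero    b ρ = b ∷ᵛ ρ
insert (suc j) b ρ = ρ zero ∷ᵛ insert j b (ρ ∘ suc)

insert-< : ∀ {j n b ρ} → n < j → insert j b ρ n ≡ ρ n
insert-< {suc j} {zero}          _         = refl
insert-< {suc j} {suc n} {ρ = ρ} (s≤s n<j) = insert-< {j} {ρ = ρ ∘ suc} n<j

insert-≡ : ∀ j {b ρ} → insert j b ρ j ≡ b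
insert-≡ zero            = refl
insert-≡ (suc j) {ρ = ρ} = insert-≡ j {ρ = ρ ∘ suc}

insert-> : ∀ {j m b ρ} → j ≤ m → insert j b ρ (suc m) ≡ ρ m
insert-> {zero}                  _         = refl
insert-> {suc j} {suc m} {ρ = ρ} (s≤s j≤m) = insert-> {j} {ρ = ρ ∘ suc} j≤m

sub-⟦⟧ : ∀ j S A ρ → ⟦ sub j S A ⟧ ρ ≡ ⟦ A ⟧ (insert j (⟦ S ⟧ ρ) ρ)
sub-⟦⟧ j S (tvar n) ρ with varView j n
... | below n<j rewrite subVar-< {S = S} n<j = sym (insert-< n<j)
... | at        rewrite subVar-≡ {j} {S} refl = sym (insert-≡ j)
... | above j≤m rewrite subVar-> {S = S} j≤m = sym (insert-> j≤m)
sub-⟦⟧ j S ⊥'      ρ = refl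
sub-⟦⟧ j S (A ⇒ B) ρ = cong₂ (λ a b → not a ∨ b) (sub-⟦⟧ j S A ρ) (sub-⟦⟧ j S B ρ)
sub-⟦⟧ j S (∀' A)  ρ = cong₂ _∧_ (extend true) (extend false)
  where
  extend : ∀ b → ⟦ sub (suc j) (shift 0 S) A ⟧ (b ∷ᵛ ρ) ≡ ⟦ A ⟧ (b ∷ᵛ insert j (⟦ S ⟧ ρ) ρ)
  extend b = trans (sub-⟦⟧ (suc j) (shift 0 S) A (b ∷ᵛ ρ))
                   (cong (λ v → ⟦ A ⟧ (b ∷ᵛ insert j v ρ)) (shift-⟦⟧-∷ S b ρ))

⊨-⇒-intro : ∀ {ρ} A B → (ρ ⊨ A → ρ ⊨ B) → ρ ⊨ A ⇒ B
⊨-⇒-intro {ρ} A B f with ⟦ A ⟧ ρ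
... | false = tt
... | true  = f tt

⊨-⇒-elim : ∀ {ρ} A B → ρ ⊨ A ⇒ B → ρ ⊨ A → ρ ⊨ B
⊨-⇒-elim {ρ} A B h _ with ⟦ A ⟧ ρ
... | true = h

⊨-∀-elim : ∀ {ρ} A b → ρ ⊨ ∀' A → (b ∷ᵛ ρ) ⊨ A
⊨-∀-elim A true  h = proj₁ (Equivalence.to T-∧ h)
⊨-∀-elim A false h = proj₂ (Equivalence.to T-∧ h)

⊨-∋ : ∀ {ρ Γ n A} → All (ρ ⊨_) Γ → Γ ∋ n ∶ A → ρ ⊨ A
⊨-∋ (a ∷ _)  here      = a
⊨-∋ (_ ∷ as) (there p) = ⊨-∋ as p

⊨-shift : ∀ {ρ} b {Γ} → All (ρ ⊨_) Γ → All ((b ∷ᵛ ρ) ⊨_) (map (shift 0) Γ)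
⊨-shift {ρ} b as = map⁺ (All.map (λ {A} a → subst T (sym (shift-⟦⟧-∷ A b ρ)) a) as)

sound : ∀ {Γ t A} → Γ ⊢ t ∶ A → ∀ {ρ} → All (ρ ⊨_) Γ → ρ ⊨ A
sound (⊢var p) as                 = ⊨-∋ as p
sound (⊢lam {A = A} {B} d) as     = ⊨-⇒-intro A B (λ a → sound d (a ∷ as))
sound (⊢app {A = A} {B} d e) as   = ⊨-⇒-elim A B (sound d as) (sound e as)
sound (⊢gen d) as                 = Equivalence.from T-∧ (sound d (⊨-shift true as) , sound d (⊨-shift false as))
sound (⊢ins {A = A} {S} d) {ρ} as = subst T (sym (sub-⟦⟧ 0 S A ρ)) (⊨-∀-elim A (⟦ S ⟧ ρ) (sound d as))

-- ⟦ Qty ⟧ ρ computes to false: Peirce's law holds under every valuation.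
Qty-empty : ∀ {Γ u ρ} → All (ρ ⊨_) Γ → ¬ (Γ ⊢ u ∶ Qty)
Qty-empty ⊨Γ ⊢u = sound ⊢u ⊨Γ

target : Ty → Ty
target (A ⇒ B) = target B
target C       = C

spine-target : ∀ {Γ h t C H k} → Spine Γ h t C → Γ ∋ h ∶ H → target H ≡ tvar k → target C ≡ tvar k
spine-target (head p) q eq rewrite ∋-functional p q = eq
spine-target (s · _)  q eq = spine-target s q eq
spine-target (s [ _ ]) q eq with spine-target s q eq
... | ()

spine-tvar : ∀ {Γ h t C k} → Spine Γ h t C → Γ ∋ h ∶ tvar k → t ≡ var h × C ≡ tvar k
spine-tvar (head p) q = refl , ∋-functional p q
spine-tvar (s · _) q with spine-tvar s q
... | _ , ()
spine-tvar (s [ _ ]) q with spine-tvar s q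
... | _ , ()

spine-endo : ∀ {Γ h t C k} → Spine Γ h t C → Γ ∋ h ∶ (tvar k ⇒ tvar k) →
  (t ≡ var h × C ≡ tvar k ⇒ tvar k) ⊎ (C ≡ tvar k × Σ Tm λ u → t ≡ app (var h) u × Γ ⊢ u ∶ tvar k)
spine-endo (head p) q = inj₁ (refl , ∋-functional p q)
spine-endo (s · ⊢u) q with spine-endo s q
... | inj₁ (refl , refl) = inj₂ (refl , _ , refl , ⊢u)
... | inj₂ (() , _)
spine-endo (s [ _ ]) q with spine-endo s q
... | inj₁ (_ , ())
... | inj₂ (() , _)

spine-arg : ∀ {Γ h t C A B} → Spine Γ h t C → Γ ∋ h ∶ (A ⇒ B) → C ≡ A ⇒ B ⊎ Σ Tm λ u → Γ ⊢ u ∶ A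
spine-arg (head p) q = inj₁ (∋-functional p q)
spine-arg (_·_ {u = u} s ⊢u) q with spine-arg s q
... | inj₁ refl = inj₂ (u , ⊢u)
... | inj₂ arg  = inj₂ arg
spine-arg (s [ _ ]) q with spine-arg s q
... | inj₂ arg  = inj₂ arg

spine-Qty⇒Pty : ∀ {Γ h t C ρ} → All (ρ ⊨_) Γ → Spine Γ h t C → Γ ∋ h ∶ (Qty ⇒ Pty) → C ≡ Qty ⇒ Pty
spine-Qty⇒Pty ⊨Γ s q with spine-arg s q
... | inj₁ eq       = eq
... | inj₂ (_ , ⊢u) = ⊥-elim (Qty-empty ⊨Γ ⊢u)

boolean-body : ∀ {t} → Nf t → (tvar 0 ∷ tvar 0 ∷ tvar 1 ∷ (Bty ⇒ Dty ⇒ tvar 1) ∷ []) ⊢ t ∶ tvar 0 →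
  lam (lam t) ≡ Tt ⊎ lam (lam t) ≡ Ff
boolean-body (lam _) ⊢t with lam-inv ⊢t
... | ()
boolean-body (ne nt) ⊢t with ne-inv nt ⊢t
... | spine p@here s with spine-tvar s p
...   | refl , _ = inj₂ refl
boolean-body (ne nt) ⊢t | spine p@(there here) s with spine-tvar s p
...   | refl , _ = inj₁ refl
boolean-body (ne nt) ⊢t | spine p@(there (there here)) s         = case spine-target s p refl of λ ()
boolean-body (ne nt) ⊢t | spine p@(there (there (there here))) s = case spine-target s p refl of λ ()

boolean-λ : ∀ {t} → Nf t → (tvar 0 ∷ tvar 1 ∷ (Bty ⇒ Dty ⇒ tvar 1) ∷ []) ⊢ t ∶ (tvar 0 ⇒ tvar 0) →
  lam t ≡ Tt ⊎ lam t ≡ Ff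
boolean-λ (lam nf) ⊢t with lam-inv ⊢t
... | ⇒-intro ⊢body = boolean-body nf ⊢body
boolean-λ (ne nt) ⊢t with ne-inv nt ⊢t
... | spine p@here s with spine-tvar s p
...   | _ , ()
boolean-λ (ne nt) ⊢t | spine p@(there here) s         = case spine-target s p refl of λ ()
boolean-λ (ne nt) ⊢t | spine p@(there (there here)) s = case spine-target s p refl of λ ()

-- A neutral inhabitant of a ∀-type is instantiated at ⊥', whose target no variable has.
booleans : ∀ {t} → Nf t → Γ₀ ⊢ t ∶ Bty → t ≡ Tt ⊎ t ≡ Ff
booleans (lam nf) ⊢t with lam-inv ⊢t
... | ∀-intro (⇒-intro ⊢body) = boolean-λ nf ⊢body
booleans (ne nt) ⊢t with ne-inv nt (⊢ins {S = ⊥'} ⊢t)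
... | spine p@here s         = case spine-target s p refl of λ ()
... | spine p@(there here) s = case spine-target s p refl of λ ()

-- The context is f : X′ → X′, z : X′, α : Q → P, y : X, x : B → D → X (with X′ fresh),
-- and all its types hold when every type variable is true.
numeral-body : ∀ {t} → Nf t →
  ((tvar 0 ⇒ tvar 0) ∷ tvar 0 ∷ Qty ⇒ Pty ∷ tvar 1 ∷ (Bty ⇒ Dty ⇒ tvar 1) ∷ []) ⊢ t ∶ tvar 0 →
  Σ ℕ λ n → lam (lam (lam t)) ≡ d n
numeral-body (lam _) ⊢t with lam-inv ⊢t
... | ()
numeral-body (ne nt) ⊢t with ne-inv nt ⊢t
... | spine p@here s with spine-endo s p
...   | inj₁ (_ , ())
numeral-body (ne (app _ nu)) ⊢t | spine p@here s | inj₂ (_ , _ , refl , ⊢u) with numeral-body nu ⊢u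
...   | n , refl = suc n , refl
numeral-body (ne nt) ⊢t | spine p@(there here) s with spine-tvar s p
...   | refl , _ = 0 , refl
numeral-body (ne nt) ⊢t | spine p@(there (there here)) s =
  case spine-Qty⇒Pty {ρ = λ _ → true} (_ ∷ _ ∷ _ ∷ _ ∷ _ ∷ []) s p of λ ()
numeral-body (ne nt) ⊢t | spine p@(there (there (there here))) s         = case spine-target s p refl of λ ()
numeral-body (ne nt) ⊢t | spine p@(there (there (there (there here)))) s = case spine-target s p refl of λ ()

numeral-λ₂ : ∀ {t} → Nf t →
  (tvar 0 ∷ Qty ⇒ Pty ∷ tvar 1 ∷ (Bty ⇒ Dty ⇒ tvar 1) ∷ []) ⊢ t ∶ ((tvar 0 ⇒ tvar 0) ⇒ tvar 0) →
  Σ ℕ λ n → lam (lam t) ≡ d n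
numeral-λ₂ (lam nf) ⊢t with lam-inv ⊢t
... | ⇒-intro ⊢body = numeral-body nf ⊢body
numeral-λ₂ (ne nt) ⊢t with ne-inv nt ⊢t
... | spine p@here s with spine-tvar s p
...   | _ , ()
numeral-λ₂ (ne nt) ⊢t | spine p@(there here) s =
  case spine-Qty⇒Pty {ρ = λ _ → true} (_ ∷ _ ∷ _ ∷ _ ∷ []) s p of λ ()
numeral-λ₂ (ne nt) ⊢t | spine p@(there (there here)) s         = case spine-target s p refl of λ ()
numeral-λ₂ (ne nt) ⊢t | spine p@(there (there (there here))) s = case spine-target s p refl of λ ()

numeral-λ₁ : ∀ {t} → Nf t → (Qty ⇒ Pty ∷ Γ₀) ⊢ t ∶ Nty → Σ ℕ λ n → lam t ≡ d n
numeral-λ₁ (lam nf) ⊢t with lam-inv ⊢t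
... | ∀-intro (⇒-intro ⊢body) = numeral-λ₂ nf ⊢body
numeral-λ₁ (ne nt) ⊢t with ne-inv nt (⊢ins {S = ⊥'} ⊢t)
... | spine p@here s                 = case spine-Qty⇒Pty {ρ = λ _ → true} (_ ∷ _ ∷ _ ∷ []) s p of λ ()
... | spine p@(there here) s         = case spine-target s p refl of λ ()
... | spine p@(there (there here)) s = case spine-target s p refl of λ ()

numerals : ∀ {t} → Nf t → Γ₀ ⊢ t ∶ Dty → Σ ℕ λ n → t ≡ d n
numerals (lam nf) ⊢t with lam-inv ⊢t
... | ⇒-intro ⊢body = numeral-λ₁ nf ⊢body
numerals (ne nt) ⊢t with ne-inv nt ⊢t
... | spine p@here s         = case spine-target s p refl of λ ()
... | spine p@(there here) s = case spine-target s p refl of λ ()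

mainTheorem8 : (t : Tm) → Nf t →
    ((Γ₀ ⊢ t ∶ Bty) → (t ≡ Tt) ⊎ (t ≡ Ff))
    × ((Γ₀ ⊢ t ∶ Dty) → Σ ℕ (λ n → t ≡ d n))
mainTheorem8 t nf = booleans nf , numerals nf
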